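{- Let $\mathcal{A}=(A_0,A_1,\mathcal{F})$ with $\mathcal{F}=\mathcal{G}_0\cup\mathcal{G}_1\cup\{h\}$, where: - $\mathcal{G}_0$ consists of operations on $A_0$; - $\mathcal{G}_1$ consists of operations on $A_1$; - $h:A_1\to A_0$ is a homomorphism from $(A_1,\mathcal{G}_1)$ into $\mathcal{A}_0=(A_0,\mathcal{G}_0)$. Suppose $\mathcal{A}_0$ is not a Ramsey algebra, and that there exist $\vec{\beta}\in{}^\omega\mathrm{im}(h)$ and $X\subseteq A_0$ witnessing this: no $\vec{u}\le_{\mathcal{G}_0}\vec{\beta}$ satisfies $\mathrm{FR}_{\mathcal{G}_0}(\vec{u})\subseteq X$ or $\mathrm{FR}_{\mathcal{G}_0}(\vec{u})\cap X=\varnothing$. Then $\mathcal{A}$ is not an $\vec{e}$-Ramsey algebra for any $\vec{e}\in\Omega_0$.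
   Context: An algebra is a pair $(\{A_\xi\}_{\xi\in I},\mathcal{F})$ with nonempty, pairwise disjoint phyla and a family $\mathcal{F}$ of operations, each with domain a finite product of phyla and codomain a phylum. An operation "on $A_i$" has all arguments and values in $A_i$. A sort is $\vec{e}\in{}^\omega I$, and $\vec{b}$ is $\vec{e}$-sorted if $\vec{b}(i)\in A_{\vec{e}(i)}$ for all $i$. Orderly terms: $\mathcal{F}_0=\mathcal{F}\cup\{\mathrm{id}_{A_\xi}\}$. $\mathcal{F}_{k+1}$ is $\mathcal{F}_k$ plus all $f$ with $f(\vec{x})=g(h_1(\vec{x}_1),\dots,h_N(\vec{x}_N))$, where $g\in\mathcal{F}$ is $N$-ary, $h_i\in\mathcal{F}_k$, and $\vec{x}_1\ast\cdots\ast\vec{x}_N=\vec{x}$ is the argument list of $f$ (concatenation). $\mathrm{OT}(\mathcal{F})=\bigcup_k\mathcal{F}_k$. $\vec{a}\le_\mathcal{F}\vec{b}$ means: for each $j$ there are a finite subsequence $\vec{b}_j$ of $\vec{b}$ and $f_j\in\mathrm{OT}(\mathcal{F})$ with $\vec{a}(j)=f_j(\vec{b}_j)$, and $\vec{b}_0\ast\vec{b}_1\ast\cdots$ is a subsequence of $\vec{b}$. $\mathrm{FR}^{\vec{e}}_\mathcal{F}(\vec{b})=\{\vec{a}(0):\vec{a}\le_\mathcal{F}\vec{b},\ \vec{a}\ \vec{e}\text{ -sorted}\}$. $\vec{e}$-Ramsey algebra: for every $\vec{e}$-sorted $\vec{b}$ and $X\subseteq A_{\vec{e}(0)}$ some $\vec{e}$-sorted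 $\vec{a}\le_\mathcal{F}\vec{b}$ has $\mathrm{FR}^{\vec{e}}_\mathcal{F}(\vec{a})\subseteq X$ or disjoint from $X$. For a homogeneous algebra $(A,\mathcal{G})$, $\mathrm{FR}_\mathcal{G}(\vec{b})=\{\vec{a}(0):\vec{a}\le_\mathcal{G}\vec{b}\}$. It is a Ramsey algebra if for every $\vec{b}\in{}^\omega A$ and $X\subseteq A$ some $\vec{a}\le_\mathcal{G}\vec{b}$ has $\mathrm{FR}_\mathcal{G}(\vec{a})\subseteq X$ or disjoint from $X$. $\Omega$ is the set of sorts each of whose values is taken infinitely often, and $\Omega_0=\{\vec{e}\in\Omega:\vec{e}(0)=0\}$. Homomorphism: there is an arity-preserving bijection between $\mathcal{G}_1$ and $\mathcal{G}_0$, and for each $n$-ary $F\in\mathcal{G}_1$ with corresponding $f\in\mathcal{G}_0$ and all $a_i\in A_1$, $h(F(a_1,\dots,a_n))=f(h(a_1),\dots,h(a_n))$. -}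

module Defs where

open import Data.Nat using (ℕ; zero; suc; _<_; _≤_)
open import Data.Fin using (Fin; zero; suc)
open import Data.List using (List; []; _∷_; _++_; map; replicate)
open import Data.List.Relation.Unary.All using (All; []; _∷_)
open import Data.List.Relation.Unary.Linked using (Linked)
open import Data.Vec using (Vec) renaming ([] to []ᵛ; _∷_ to _∷ᵛ_; map to mapᵛ)
open import Data.Product using (Σ; _×_; _,_; proj₁; proj₂; ∃)
open import Data.Sum using (_⊎_; inj₁; inj₂)
open import Data.Unit using (⊤; tt)
open import Data.Empty using (⊥)
open import Relation.Binary.PropositionalEquality using (_≡_; subst; sym)
open import Function.Bundles using (_⤖_; Bijection)

record Alg (I : Set) : Set₁ where
  field
    Ph  : I → Set
    Op  : Set
    dom : Op → List I
    cod : Op → I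
    op  : (k : Op) → All Ph (dom k) → Ph (cod k)

module _ {I : Set} (𝒜 : Alg I) where
  open Alg 𝒜

  -- Orderly terms OT(F): OT ds i is an orderly term whose argument list has
  -- sorts ds and whose value lies in phylum i.
  --   var i        : the identity on A_i
  --   app g (h₁ … hₙ) : x ↦ g(h₁(x₁),…,hₙ(xₙ)) with x = x₁ * ⋯ * xₙ
  mutual
    data OT : List I → I → Set where
      var : (i : I) → OT (i ∷ []) i
      app : ∀ {ds} (k : Op) → OTs ds (dom k) → OT ds (cod k)

    data OTs : List I → List I → Set where
      []  : OTs [] []
      _∷_ : ∀ {ds es i is} → OT ds i → OTs es is → OTs (ds ++ es) (i ∷ is)

  splitAll : ∀ ds {es} → All Ph (ds ++ es) → All Ph ds × All Ph es
  splitAll [] xs = [] , xs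
  splitAll (d ∷ ds) (x ∷ xs) with splitAll ds xs
  ... | ys , zs = (x ∷ ys) , zs

  mutual
    eval : ∀ {ds i} → OT ds i → All Ph ds → Ph i
    eval (var i) (x ∷ []) = x
    eval (app k ts) xs = op k (evals ts xs)

    evals : ∀ {ds is} → OTs ds is → All Ph ds → All Ph is
    evals [] _ = []
    evals (_∷_ {ds} t ts) xs =
      eval t (proj₁ (splitAll ds xs)) ∷ evals ts (proj₂ (splitAll ds xs))

  Seq : (ℕ → I) → Set
  Seq e = (n : ℕ) → Ph (e n)

  pick : ∀ {e} → Seq e → (is : List ℕ) → All Ph (map e is)
  pick b [] = []
  pick b (i ∷ is) = b i ∷ pick b is

  -- a ≤_F b  (a is e'-sorted, b is e-sorted).  b_j is the subsequence of b at
  -- the strictly increasing positions idx j; the concatenation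
  -- b_0 * b_1 * ⋯ is a subsequence of b, i.e. all positions of idx j lie
  -- below all positions of idx j' whenever j < j'.
  record LeF (e' e : ℕ → I) (a : Seq e') (b : Seq e) : Set where
    field
      idx        : ℕ → List ℕ
      increasing : ∀ j → Linked _<_ (idx j)
      separated  : ∀ j j' → j < j' → All (λ x → All (x <_) (idx j')) (idx j)
      term       : ∀ j → OT (map e (idx j)) (e' j)
      equation   : ∀ j → a j ≡ eval (term j) (pick b (idx j))

  FR : (e : ℕ → I) → Seq e → Ph (e 0) → Set
  FR e b x = Σ (Seq e) λ a → LeF e e a b × (a 0 ≡ x)

  IsRamsey : (ℕ → I) → Set₁
  IsRamsey e = (b : Seq e) (X : Ph (e 0) → Set) →
    Σ (Seq e) λ a → LeF e e a b ×
      ((∀ x → FR e a x → X x) ⊎ (∀ x → FR e a x → X x → ⊥))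

record HAlg : Set₁ where
  field
    Carrier : Set
    Op      : Set
    ar      : Op → ℕ
    op      : (j : Op) → Vec Carrier (ar j) → Carrier

allRep : ∀ {I : Set} (P : I → Set) (i : I) n → All P (replicate n i) → Vec (P i) n
allRep P i zero [] = []ᵛ
allRep P i (suc n) (x ∷ xs) = x ∷ᵛ allRep P i n xs

toAlg : HAlg → Alg ⊤
toAlg G = record
  { Ph  = λ _ → Carrier
  ; Op  = Op
  ; dom = λ j → replicate (ar j) tt
  ; cod = λ _ → tt
  ; op  = λ j xs → op j (allRep (λ _ → Carrier) tt (ar j) xs)
  }
  where open HAlg G

LeH : (G : HAlg) → (ℕ → HAlg.Carrier G) → (ℕ → HAlg.Carrier G) → Set
LeH G a b = LeF (toAlg G) (λ _ → tt) (λ _ → tt) a b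

FRH : (G : HAlg) → (ℕ → HAlg.Carrier G) → HAlg.Carrier G → Set
FRH G b = FR (toAlg G) (λ _ → tt) b

IsRamseyH : HAlg → Set₁
IsRamseyH G = IsRamsey (toAlg G) (λ _ → tt)

record IsHom (G₁ G₀ : HAlg) (h : HAlg.Carrier G₁ → HAlg.Carrier G₀) : Set where
  field
    σ       : HAlg.Op G₁ ⤖ HAlg.Op G₀
    arity   : ∀ j → HAlg.ar G₀ (Bijection.to σ j) ≡ HAlg.ar G₁ j
    commute : ∀ j (v : Vec (HAlg.Carrier G₁) (HAlg.ar G₁ j)) →
      h (HAlg.op G₁ j v) ≡
        HAlg.op G₀ (Bijection.to σ j)
          (subst (Vec (HAlg.Carrier G₀)) (sym (arity j)) (mapᵛ h v))

module _ (G₀ G₁ : HAlg) (h : HAlg.Carrier G₁ → HAlg.Carrier G₀) where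
  private
    Ph₂ : Fin 2 → Set
    Ph₂ zero = HAlg.Carrier G₀
    Ph₂ (suc zero) = HAlg.Carrier G₁

    Op₂ : Set
    Op₂ = HAlg.Op G₀ ⊎ (HAlg.Op G₁ ⊎ ⊤)

    dom₂ : Op₂ → List (Fin 2)
    dom₂ (inj₁ j) = replicate (HAlg.ar G₀ j) zero
    dom₂ (inj₂ (inj₁ j)) = replicate (HAlg.ar G₁ j) (suc zero)
    dom₂ (inj₂ (inj₂ tt)) = suc zero ∷ []

    cod₂ : Op₂ → Fin 2
    cod₂ (inj₁ j) = zero
    cod₂ (inj₂ (inj₁ j)) = suc zero
    cod₂ (inj₂ (inj₂ tt)) = zero

    op₂ : (k : Op₂) → All Ph₂ (dom₂ k) → Ph₂ (cod₂ k)
    op₂ (inj₁ j) xs = HAlg.op G₀ j (allRep Ph₂ zero (HAlg.ar G₀ j) xs)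
    op₂ (inj₂ (inj₁ j)) xs = HAlg.op G₁ j (allRep Ph₂ (suc zero) (HAlg.ar G₁ j) xs)
    op₂ (inj₂ (inj₂ tt)) (x ∷ []) = h x

  TwoSorted : Alg (Fin 2)
  TwoSorted = record { Ph = Ph₂ ; Op = Op₂ ; dom = dom₂ ; cod = cod₂ ; op = op₂ }

Ω₀ : (ℕ → Fin 2) → Set
Ω₀ e = (e 0 ≡ zero) × (∀ n m → ∃ λ k → (m ≤ k) × (e k ≡ e n))

module Submission where

open import Defs
open import Data.Nat using (ℕ)
open import Data.Fin using (Fin)
open import Data.Product using (Σ; _×_; ∃)
open import Data.Sum using (_⊎_)
open import Data.Empty using (⊥)
open import Relation.Nullary using (¬_)
open import Relation.Binary.PropositionalEquality using (_≡_)

open import Data.Nat using (zero; suc; _<_; _≤_; s≤s)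
open import Data.Nat.Properties using (≤-trans; <-trans; m≤n⇒m<n∨m≡n; m≤n⇒m≤1+n; m≤m+n; m≤n+m)
open import Data.Nat.ListAction using (sum)
open import Data.Fin using () renaming (zero to fz; suc to fs)
open import Data.List using (List; []; _∷_; _++_; map; replicate)
open import Data.List.Relation.Unary.All as All using (All; []; _∷_)
open import Data.List.Relation.Unary.Linked using (Linked; [-])
open import Data.Vec using (Vec) renaming (_∷_ to _∷ᵛ_; map to mapᵛ)
open import Data.Vec.Properties using (map-id)
open import Data.Product using (_,_; proj₁; proj₂)
open import Data.Sum using (inj₁; inj₂)
open import Data.Unit using (⊤; tt)
open import Function using (_∘_)
open import Function.Bundles using (Bijection)
open import Relation.Binary.PropositionalEquality using (refl; sym; trans; cong; cong₂; subst; module ≡-Reasoning)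

-- Let ĥ : A₀ ∪ A₁ → A₀ be the identity on A₀ and h on
-- A₁ ("collapse").  Suppose 𝒜 were e-Ramsey for some e ∈ Ω₀.  Lift β to an
-- e-sorted b with ĥ ∘ b = β (possible since β ranges in im h), apply the
-- Ramsey property to b and ĥ⁻¹(X), and obtain a ≤_F b with FR^e(a)
-- homogeneous for ĥ⁻¹(X).  Then u = ĥ ∘ a contradicts the choice of β and X:
--   * u ≤_{G₀} β, because every orderly term of 𝒜 erases to an orderly term
--     of G₀ commuting with ĥ (h is a homomorphism, G₁ ↔ G₀ via σ);
--   * FR_{G₀}(u) ⊆ ĥ(FR^e(a)), because every orderly term of G₀ lifts to one
--     of 𝒜 of sort 0 (insert h in front of the A₁-arguments), and in any
--     algebra whose sort e recurs, the value of a single orderly term on an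
--     increasing finite subsequence of a lies in FR^e(a);
--   * homogeneity passes from FR^e(a) to any set contained in its ĥ-image.

Recurrent : {I : Set} → (ℕ → I) → Set
Recurrent e = ∀ n m → ∃ λ k → (m ≤ k) × (e k ≡ e n)

below-1+sum : ∀ l → All (_< suc (sum l)) l
below-1+sum [] = []
below-1+sum (x ∷ l) =
  s≤s (m≤m+n x (sum l)) ∷ All.map (λ p → ≤-trans p (s≤s (m≤n+m (sum l) x))) (below-1+sum l)

module LaterCopies {I : Set} (e : ℕ → I) (rec : Recurrent e) (M : ℕ) where

  copy : ℕ → ℕ
  copy zero = proj₁ (rec 1 M)
  copy (suc j) = proj₁ (rec (suc (suc j)) (suc (copy j)))

  copy-sort : ∀ j → e (copy j) ≡ e (suc j)
  copy-sort zero = proj₂ (proj₂ (rec 1 M))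
  copy-sort (suc j) = proj₂ (proj₂ (rec (suc (suc j)) (suc (copy j))))

  copy-step : ∀ j → copy j < copy (suc j)
  copy-step j = proj₁ (proj₂ (rec (suc (suc j)) (suc (copy j))))

  copy-above : ∀ j → M ≤ copy j
  copy-above zero = proj₁ (proj₂ (rec 1 M))
  copy-above (suc j) = ≤-trans (m≤n⇒m≤1+n (copy-above j)) (copy-step j)

  copy-mono : ∀ {j j'} → j < j' → copy j < copy j'
  copy-mono {j} {suc j'} (s≤s j≤j') with m≤n⇒m<n∨m≡n j≤j'
  ... | inj₁ j<j' = <-trans (copy-mono j<j') (copy-step j')
  ... | inj₂ refl = copy-step j

-- In any algebra with a recurrent sort e, the value of one orderly term of
-- sort e(0) on an increasing finite subsequence of a lies in FR^e(a): the
-- witness applies the term first and then copies later entries of a of the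
-- required sorts.
termValue∈FR : {I : Set} (𝒜 : Alg I) (e : ℕ → I) → Recurrent e → (a : Seq 𝒜 e) →
  (is : List ℕ) → Linked _<_ is → (t : OT 𝒜 (map e is) (e 0)) →
  FR 𝒜 e a (eval 𝒜 t (pick 𝒜 {e = e} a is))
termValue∈FR 𝒜 e rec a is is-increasing t = c , c≤a , refl
  where
  open LaterCopies e rec (suc (sum is))

  positions : ℕ → List ℕ
  positions zero = is
  positions (suc j) = copy j ∷ []

  terms : ∀ j → OT 𝒜 (map e (positions j)) (e j)
  terms zero = t
  terms (suc j) = subst (OT 𝒜 (e (copy j) ∷ [])) (copy-sort j) (var (e (copy j)))

  c : Seq 𝒜 e
  c j = eval 𝒜 (terms j) (pick 𝒜 {e = e} a (positions j))

  increasing : ∀ j → Linked _<_ (positions j)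
  increasing zero = is-increasing
  increasing (suc j) = [-]

  separated : ∀ j j' → j < j' → All (λ x → All (x <_) (positions j')) (positions j)
  separated zero (suc j') _ = All.map (λ p → ≤-trans p (copy-above j') ∷ []) (below-1+sum is)
  separated (suc j) (suc j') (s≤s j<j') = (copy-mono j<j' ∷ []) ∷ []

  c≤a : LeF 𝒜 e e c a
  c≤a = record { idx = positions ; increasing = increasing ; separated = separated
               ; term = terms ; equation = λ _ → refl }

Homogeneous : {A : Set} → (A → Set) → (A → Set) → Set
Homogeneous F X = (∀ x → F x → X x) ⊎ (∀ x → F x → X x → ⊥)

homogeneous-image : {A B : Set} (f : A → B) {F : A → Set} {F' : B → Set} {X : B → Set} →
  (∀ y → F' y → Σ A λ x → F x × (f x ≡ y)) →
  Homogeneous F (X ∘ f) → Homogeneous F' X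
homogeneous-image f {X = X} F'⊆fF (inj₁ inside) =
  inj₁ λ y y∈F' → let (x , x∈F , fx≡y) = F'⊆fF y y∈F' in subst X fx≡y (inside x x∈F)
homogeneous-image f {X = X} F'⊆fF (inj₂ outside) =
  inj₂ λ y y∈F' y∈X → let (x , x∈F , fx≡y) = F'⊆fF y y∈F' in outside x x∈F (subst X (sym fx≡y) y∈X)

module Collapse (G₀ G₁ : HAlg) (h : HAlg.Carrier G₁ → HAlg.Carrier G₀) (hom : IsHom G₁ G₀ h) where
  open IsHom hom

  C₀ : Set
  C₀ = HAlg.Carrier G₀

  𝒜 : Alg (Fin 2)
  𝒜 = TwoSorted G₀ G₁ h

  H : Alg ⊤
  H = toAlg G₀

  P : Fin 2 → Set
  P = Alg.Ph 𝒜

  Args₀ : List ⊤ → Set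
  Args₀ = All (λ _ → C₀)

  collapse : (i : Fin 2) → P i → C₀
  collapse fz x = x
  collapse (fs fz) x = h x

  data Erases : List (Fin 2) → List ⊤ → Set where
    []  : Erases [] []
    _∷_ : ∀ {ds d'} (d : Fin 2) → Erases ds d' → Erases (d ∷ ds) (tt ∷ d')

  data Collapses : ∀ {ds d'} → All P ds → Args₀ d' → Set where
    []  : Collapses [] []
    _∷_ : ∀ {d ds d' x y} {xs : All P ds} {ys : Args₀ d'} →
          collapse d x ≡ y → Collapses xs ys → Collapses {d ∷ ds} {tt ∷ d'} (x ∷ xs) (y ∷ ys)

  erases-++ : ∀ {a a' b b'} → Erases a a' → Erases b b' → Erases (a ++ b) (a' ++ b')
  erases-++ [] t = t
  erases-++ (d ∷ s) t = d ∷ erases-++ s t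

  erases-++[] : ∀ {ds d'} → Erases ds d' → Erases (ds ++ []) d'
  erases-++[] [] = []
  erases-++[] (d ∷ s) = d ∷ erases-++[] s

  data SplitErasure : List (Fin 2) → List ⊤ → List ⊤ → Set where
    split : ∀ {a b a' b'} → Erases a a' → Erases b b' → SplitErasure (a ++ b) a' b'

  splitErasure : ∀ ds a' {b'} → Erases ds (a' ++ b') → SplitErasure ds a' b'
  splitErasure ds [] s = split [] s
  splitErasure (d ∷ ds) (tt ∷ a') (_ ∷ s) with splitErasure ds a' s
  ... | split s₁ s₂ = split (d ∷ s₁) s₂

  collapses-split : ∀ ds {es} ds' {es'} → Erases ds ds' →
    ∀ {xs : All P (ds ++ es)} {ys : Args₀ (ds' ++ es')} → Collapses xs ys →
    Collapses (proj₁ (splitAll 𝒜 ds xs)) (proj₁ (splitAll H ds' ys)) ×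
    Collapses (proj₂ (splitAll 𝒜 ds xs)) (proj₂ (splitAll H ds' ys))
  collapses-split [] [] [] c = [] , c
  collapses-split (d ∷ ds) (tt ∷ ds') (_ ∷ s) {x ∷ xs} {y ∷ ys} (p ∷ c)
    with splitAll 𝒜 ds xs | splitAll H ds' ys | collapses-split ds ds' s c
  ... | _ , _ | _ , _ | c₁ , c₂ = (p ∷ c₁) , c₂

  -- The argument list of the unary h-operation has the form ds ++ [].
  collapses-++[] : ∀ ds {d'} {xs : All P (ds ++ [])} {ys : Args₀ d'} → Erases ds d' →
    Collapses xs ys → Collapses (proj₁ (splitAll 𝒜 ds xs)) ys
  collapses-++[] [] [] [] = []
  collapses-++[] (d ∷ ds) {xs = x ∷ xs} (_ ∷ s) (p ∷ c) with splitAll 𝒜 ds xs | collapses-++[] ds s c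
  ... | _ , _ | c' = p ∷ c'

  Erased : List (Fin 2) → Set
  Erased ds = Σ (List ⊤) λ d' → Erases ds d' × OT H d' tt

  ErasedList : List (Fin 2) → ℕ → Set
  ErasedList ds n = Σ (List ⊤) λ d' → Erases ds d' × OTs H d' (replicate n tt)

  mutual
    erase : ∀ {ds i} → OT 𝒜 ds i → Erased ds
    erase (var i) = _ , (i ∷ []) , var tt
    erase (app (inj₁ j) ts) =
      let (d' , s , us) = eraseList ts in d' , s , app j us
    erase (app (inj₂ (inj₁ j)) ts) =
      let (d' , s , us) = eraseList ts
      in d' , s , app (Bijection.to σ j) (subst (λ n → OTs H d' (replicate n tt)) (sym (arity j)) us)
    erase (app (inj₂ (inj₂ tt)) (t ∷ [])) =
      let (d' , s , u) = erase t in d' , erases-++[] s , u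

    eraseList : ∀ {n i ds} → OTs 𝒜 ds (replicate n i) → ErasedList ds n
    eraseList {zero} [] = [] , [] , []
    eraseList {suc n} (t ∷ ts) =
      let (d₁ , s₁ , u) = erase t ; (d₂ , s₂ , us) = eraseList ts
      in d₁ ++ d₂ , erases-++ s₁ s₂ , u ∷ us

  evals-cast : ∀ {m n d'} (p : m ≡ n) (us : OTs H d' (replicate n tt)) ys →
    allRep (λ _ → C₀) tt m (evals H (subst (λ k → OTs H d' (replicate k tt)) (sym p) us) ys)
      ≡ subst (Vec C₀) (sym p) (allRep (λ _ → C₀) tt n (evals H us ys))
  evals-cast refl us ys = refl

  -- The erased term evaluated on collapsed arguments is the collapse of the
  -- value; for G₁-operations this is exactly the homomorphism property.
  mutual
    erase-correct : ∀ {ds i} (t : OT 𝒜 ds i) {xs : All P ds} {ys : Args₀ (proj₁ (erase t))} →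
      Collapses xs ys → eval H (proj₂ (proj₂ (erase t))) ys ≡ collapse i (eval 𝒜 t xs)
    erase-correct (var i) (p ∷ []) = sym p
    erase-correct (app (inj₁ j) ts) c =
      cong (HAlg.op G₀ j) (trans (eraseList-correct ts c) (map-id _))
    erase-correct (app (inj₂ (inj₁ j)) ts) {xs} {ys} c = begin
      HAlg.op G₀ (Bijection.to σ j) (allRep _ tt _ (evals H (subst (λ n → OTs H d' (replicate n tt)) (sym (arity j)) us) ys))
        ≡⟨ cong (HAlg.op G₀ (Bijection.to σ j)) (evals-cast (arity j) us ys) ⟩
      HAlg.op G₀ (Bijection.to σ j) (subst (Vec C₀) (sym (arity j)) (allRep _ tt _ (evals H us ys)))
        ≡⟨ cong (λ v → HAlg.op G₀ (Bijection.to σ j) (subst (Vec C₀) (sym (arity j)) v))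
                (eraseList-correct ts c) ⟩
      HAlg.op G₀ (Bijection.to σ j) (subst (Vec C₀) (sym (arity j)) (mapᵛ h (allRep P (fs fz) _ (evals 𝒜 ts xs))))
        ≡⟨ sym (commute j _) ⟩
      h (HAlg.op G₁ j (allRep P (fs fz) _ (evals 𝒜 ts xs))) ∎
      where
      open ≡-Reasoning
      d' : List ⊤
      d' = proj₁ (eraseList ts)
      us : OTs H d' (replicate (HAlg.ar G₁ j) tt)
      us = proj₂ (proj₂ (eraseList ts))
    erase-correct (app (inj₂ (inj₂ tt)) (_∷_ {ds} t [])) c =
      erase-correct t (collapses-++[] ds (proj₁ (proj₂ (erase t))) c)

    eraseList-correct : ∀ {n i ds} (ts : OTs 𝒜 ds (replicate n i)) {xs : All P ds}
      {ys : Args₀ (proj₁ (eraseList ts))} → Collapses xs ys →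
      allRep (λ _ → C₀) tt n (evals H (proj₂ (proj₂ (eraseList ts))) ys)
        ≡ mapᵛ (collapse i) (allRep P i n (evals 𝒜 ts xs))
    eraseList-correct {zero} [] c = refl
    eraseList-correct {suc n} (_∷_ {ds} t ts) {xs} {ys} c =
      let (c₁ , c₂) = collapses-split ds (proj₁ (erase t)) (proj₁ (proj₂ (erase t))) {xs} {ys} c
      in cong₂ _∷ᵛ_ (erase-correct t c₁) (eraseList-correct ts c₂)

  mutual
    lift : ∀ {d'} → OT H d' tt → ∀ ds → Erases ds d' → OT 𝒜 ds fz
    lift (var _) (fz ∷ []) (_ ∷ []) = var fz
    lift (var _) (fs fz ∷ []) (_ ∷ []) = app (inj₂ (inj₂ tt)) (var (fs fz) ∷ [])
    lift (app j us) ds s = app (inj₁ j) (liftList us ds s)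

    liftList : ∀ {n d'} → OTs H d' (replicate n tt) → ∀ ds → Erases ds d' → OTs 𝒜 ds (replicate n fz)
    liftList {zero} [] [] [] = []
    liftList {suc n} (_∷_ {d₁} u us) ds s with splitErasure ds d₁ s
    ... | split s₁ s₂ = lift u _ s₁ ∷ liftList us _ s₂

  mutual
    lift-correct : ∀ {d'} (u : OT H d' tt) ds s {xs : All P ds} {ys : Args₀ d'} →
      Collapses xs ys → eval 𝒜 (lift u ds s) xs ≡ eval H u ys
    lift-correct (var _) (fz ∷ []) (_ ∷ []) (p ∷ []) = p
    lift-correct (var _) (fs fz ∷ []) (_ ∷ []) (p ∷ []) = p
    lift-correct (app j us) ds s c = cong (HAlg.op G₀ j) (liftList-correct us ds s c)

    liftList-correct : ∀ {n d'} (us : OTs H d' (replicate n tt)) ds s {xs : All P ds} {ys : Args₀ d'} →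
      Collapses xs ys → allRep P fz n (evals 𝒜 (liftList us ds s) xs) ≡ allRep (λ _ → C₀) tt n (evals H us ys)
    liftList-correct {zero} [] [] [] [] = refl
    liftList-correct {suc n} (_∷_ {d₁} u us) ds s c with splitErasure ds d₁ s
    ... | split {a} s₁ s₂ =
      let (c₁ , c₂) = collapses-split a d₁ s₁ c
      in cong₂ _∷ᵛ_ (lift-correct u a s₁ c₁) (liftList-correct us _ s₂ c₂)

  module _ (e : ℕ → Fin 2) where

    erases-map : ∀ is → Erases (map e is) (map (λ _ → tt) is)
    erases-map [] = []
    erases-map (i ∷ is) = e i ∷ erases-map is

    erasure-of-map : ∀ is {d'} → Erases (map e is) d' → d' ≡ map (λ _ → tt) is
    erasure-of-map [] [] = refl
    erasure-of-map (i ∷ is) (_ ∷ s) = cong (tt ∷_) (erasure-of-map is s)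

    pick-collapses : (b : Seq 𝒜 e) (β : ℕ → C₀) → (∀ n → collapse (e n) (b n) ≡ β n) →
      ∀ is → Collapses (pick 𝒜 {e = e} b is) (pick H {e = λ _ → tt} β is)
    pick-collapses b β b↦β [] = []
    pick-collapses b β b↦β (i ∷ is) = b↦β i ∷ pick-collapses b β b↦β is

    eval-cast : ∀ {ds} {xs : All P ds} {d' d''} (eq : d' ≡ d'') (u : OT H d' tt) {v} →
      (∀ {ys} → Collapses xs ys → eval H u ys ≡ v) →
      ∀ {ys} → Collapses xs ys → eval H (subst (λ D → OT H D tt) eq u) ys ≡ v
    eval-cast refl u u≡v c = u≡v c

    collapse-≤ : (a b : Seq 𝒜 e) (β : ℕ → C₀) → (∀ n → collapse (e n) (b n) ≡ β n) →
      LeF 𝒜 e e a b → LeH G₀ (λ n → collapse (e n) (a n)) β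
    collapse-≤ a b β b↦β a≤b = record
      { idx = idx ; increasing = increasing ; separated = separated
      ; term = λ j → subst (λ D → OT H D tt) (shape j) (proj₂ (proj₂ (erase (term j))))
      ; equation = λ j → trans (cong (collapse (e j)) (equation j))
          (sym (eval-cast (shape j) (proj₂ (proj₂ (erase (term j)))) (erase-correct (term j))
                 (pick-collapses b β b↦β (idx j))))
      }
      where
      open LeF a≤b
      shape : ∀ j → proj₁ (erase (term j)) ≡ map (λ _ → tt) (idx j)
      shape j = erasure-of-map (idx j) (proj₁ (proj₂ (erase (term j))))

    collapse-subst : ∀ {ds i} (p : i ≡ fz) (t : OT 𝒜 ds fz) xs →
      collapse i (eval 𝒜 (subst (OT 𝒜 ds) (sym p) t) xs) ≡ eval 𝒜 t xs
    collapse-subst refl t xs = refl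

    -- For e ∈ Ω₀, FR_{G₀}(ĥ ∘ a) ⊆ ĥ(FR^e(a)): the first term of a reduction
    -- of ĥ ∘ a lifts to an 𝒜-term of sort e(0) = 0 on the same positions.
    collapse-FR : e 0 ≡ fz → Recurrent e → (a : Seq 𝒜 e) →
      ∀ x → FRH G₀ (λ n → collapse (e n) (a n)) x → Σ (P (e 0)) λ x' → FR 𝒜 e a x' × (collapse (e 0) x' ≡ x)
    collapse-FR e0 rec a x (c , c≤ĥa , c0≡x) =
      value , termValue∈FR 𝒜 e rec a is (increasing 0) lifted , value↦x
      where
      open LeF c≤ĥa
      is : List ℕ
      is = idx 0
      lifted : OT 𝒜 (map e is) (e 0)
      lifted = subst (OT 𝒜 (map e is)) (sym e0) (lift (term 0) (map e is) (erases-map is))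
      value : P (e 0)
      value = eval 𝒜 lifted (pick 𝒜 {e = e} a is)
      value↦x : collapse (e 0) value ≡ x
      value↦x = begin
        collapse (e 0) value
          ≡⟨ collapse-subst e0 _ (pick 𝒜 {e = e} a is) ⟩
        eval 𝒜 (lift (term 0) (map e is) (erases-map is)) (pick 𝒜 {e = e} a is)
          ≡⟨ lift-correct (term 0) (map e is) (erases-map is) (pick-collapses a _ (λ _ → refl) is) ⟩
        eval H (term 0) (pick H {e = λ _ → tt} (λ n → collapse (e n) (a n)) is)
          ≡⟨ sym (equation 0) ⟩
        c 0
          ≡⟨ c0≡x ⟩
        x ∎
        where open ≡-Reasoning

    preimage : (β : ℕ → C₀) → (∀ n → ∃ λ a → h a ≡ β n) → Σ (Seq 𝒜 e) λ b → ∀ n → collapse (e n) (b n) ≡ β n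
    preimage β β∈im = (λ n → pickSort (e n) n) , λ n → pickSort-collapses (e n) n
      where
      pickSort : (i : Fin 2) → ℕ → P i
      pickSort fz n = β n
      pickSort (fs fz) n = proj₁ (β∈im n)
      pickSort-collapses : ∀ i n → collapse i (pickSort i n) ≡ β n
      pickSort-collapses fz n = refl
      pickSort-collapses (fs fz) n = proj₂ (β∈im n)

mainTheorem12 : (G₀ G₁ : HAlg) (h : HAlg.Carrier G₁ → HAlg.Carrier G₀) →
    IsHom G₁ G₀ h →
    ¬ IsRamseyH G₀ →
    (β : ℕ → HAlg.Carrier G₀) → (∀ n → ∃ λ a → h a ≡ β n) →
    (X : HAlg.Carrier G₀ → Set) →
    ¬ (Σ (ℕ → HAlg.Carrier G₀) λ u → LeH G₀ u β ×
         ((∀ x → FRH G₀ u x → X x) ⊎ (∀ x → FRH G₀ u x → X x → ⊥))) →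
    (e : ℕ → Fin 2) → Ω₀ e → ¬ IsRamsey (TwoSorted G₀ G₁ h) e
mainTheorem12 G₀ G₁ h hom _ β β∈im X noHomogeneous e (e0 , rec) ramsey =
  noHomogeneous (u , collapse-≤ e a b β b↦β a≤b ,
                 homogeneous-image (collapse (e 0)) (collapse-FR e e0 rec a) a-homogeneous)
  where
  open Collapse G₀ G₁ h hom
  b : Seq 𝒜 e
  b = proj₁ (preimage e β β∈im)
  b↦β : ∀ n → collapse (e n) (b n) ≡ β n
  b↦β = proj₂ (preimage e β β∈im)
  a : Seq 𝒜 e
  a = proj₁ (ramsey b (X ∘ collapse (e 0)))
  a≤b : LeF 𝒜 e e a b
  a≤b = proj₁ (proj₂ (ramsey b (X ∘ collapse (e 0))))
  a-homogeneous : Homogeneous (FR 𝒜 e a) (X ∘ collapse (e 0))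
  a-homogeneous = proj₂ (proj₂ (ramsey b (X ∘ collapse (e 0))))
  u : ℕ → HAlg.Carrier G₀
  u n = collapse (e n) (a n)
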